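{- For every integer $s>0$, the numbers $p(s)=v(sJ)$ satisfy $$(s+1)^4p(s+1)=3(3s+2)(3s+1)(7s^2+7s+2)\,p(s)+72(9s^2-4)(9s^2-1)\,p(s-1).$$
   Context: A semi-magic square of size 3 is a $3\times 3$ matrix with non-negative integer entries whose row sums and column sums all equal a common value $\rho(M)$; $J$ is the all-ones $3\times3$ matrix. A lattice path from $0$ to $M$ is a sequence $0=M_0,\dots,M_{\rho(M)}=M$ with each $M_i-M_{i-1}$ a $3\times3$ permutation matrix, and $v(M)$ is the number of such paths; $p(s)=v(sJ)$, which equals $\binom{3s}{s,s,s}\sum_{t=0}^s\binom{s}{t}^3$. -}

module Defs where

open import Data.Nat using (ℕ; zero; suc; _+_; _*_; _≡ᵇ_)
open import Data.Fin using (Fin; zero; suc)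
open import Data.Fin.Properties using () renaming (_≟_ to _≟ᶠ_)
open import Data.Bool using (Bool; true; false; _∧_; if_then_else_)
open import Data.Bool.ListAction using (and)
open import Data.List using (List; []; _∷_; map; concatMap; filterᵇ; length; foldr; allFin)
open import Relation.Nullary.Decidable using (⌊_⌋)

Mat : Set
Mat = Fin 3 → Fin 3 → ℕ

zeroMat : Mat
zeroMat _ _ = 0

_⊕_ : Mat → Mat → Mat
(A ⊕ B) i j = A i j + B i j

J : Mat
J _ _ = 1

_·J : ℕ → Mat
(s ·J) _ _ = s

_==ᴹ_ : Mat → Mat → Bool
A ==ᴹ B = and (map (λ i → and (map (λ j → A i j ≡ᵇ B i j) (allFin 3))) (allFin 3))

f0 f1 f2 : Fin 3
f0 = zero
f1 = suc zero
f2 = suc (suc zero)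

mkPerm : Fin 3 → Fin 3 → Fin 3 → (Fin 3 → Fin 3)
mkPerm a b c zero = a
mkPerm a b c (suc zero) = b
mkPerm a b c (suc (suc zero)) = c

perms : List (Fin 3 → Fin 3)
perms = mkPerm f0 f1 f2 ∷ mkPerm f0 f2 f1 ∷ mkPerm f1 f0 f2
      ∷ mkPerm f1 f2 f0 ∷ mkPerm f2 f0 f1 ∷ mkPerm f2 f1 f0 ∷ []

permMat : (Fin 3 → Fin 3) → Mat
permMat σ i j = if ⌊ σ i ≟ᶠ j ⌋ then 1 else 0

steps : ℕ → List (List Mat)
steps zero = [] ∷ []
steps (suc n) = concatMap (λ σ → map (permMat σ ∷_) (steps n)) perms

endpoint : List Mat → Mat
endpoint = foldr _⊕_ zeroMat

-- number of lattice paths 0 = M_0, …, M_n = M of length n whose increments are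
-- permutation matrices (a path is determined by its sequence of increments)
pathsOfLength : ℕ → Mat → ℕ
pathsOfLength n M = length (filterᵇ (λ w → endpoint w ==ᴹ M) (steps n))

-- common line sum ρ(M), read off the first row (for semi-magic M all line sums agree)
ρ : Mat → ℕ
ρ M = M f0 f0 + M f0 f1 + M f0 f2

v : Mat → ℕ
v M = pathsOfLength (ρ M) M

p : ℕ → ℕ
p s = v (s ·J)

module Submission where

-- A path from 0 to sJ is a word in the six permutation matrices, and its endpoint only depends on
-- how often each permutation occurs.  The endpoint is sJ exactly when the three even permutations
-- occur t times each and the three odd ones s − t times each, for some t ≤ s.  By the multinomial
-- theorem there are (3s)! / (t! (s − t)!)³ such words, so p(s) = (3s)!/(s!)³ · Σₜ C(s,t)³ is a
-- central trinomial coefficient times a Franel number.  The trinomial factor satisfies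
-- (s+1)² m(s+1) = 3(3s+2)(3s+1) m(s), the Franel numbers satisfy
-- (n+1)² f(n+1) = (7n² + 7n + 2) f(n) + 8n² f(n−1) by creative telescoping, and multiplying the
-- two recurrences gives the one for p.

open import Defs
open import Data.Nat as ℕ using (ℕ; zero; suc)
open import Relation.Binary.PropositionalEquality
open ≡-Reasoning

module FiniteSums where
  open import Data.Nat using (_+_; _*_; _<_)
  open import Data.Nat.Properties using (≤-refl; m<n⇒m<1+n; *-zeroʳ; *-distribˡ-+; +-commutativeSemigroup)
  open import Algebra.Properties.CommutativeSemigroup +-commutativeSemigroup using (interchange)

  ∑ : ℕ → (ℕ → ℕ) → ℕ
  ∑ zero    f = 0
  ∑ (suc n) f = ∑ n f + f n

  infix 5 ∑
  syntax ∑ n (λ k → e) = ∑[ k < n ] e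

  ∑-cong : ∀ n {f g : ℕ → ℕ} → (∀ {k} → k < n → f k ≡ g k) → ∑ n f ≡ ∑ n g
  ∑-cong zero    f≗g = refl
  ∑-cong (suc n) f≗g = cong₂ _+_ (∑-cong n (λ k<n → f≗g (m<n⇒m<1+n k<n))) (f≗g ≤-refl)

  *-distribˡ-∑ : ∀ c n (f : ℕ → ℕ) → c * ∑ n f ≡ ∑[ k < n ] c * f k
  *-distribˡ-∑ c zero    f = *-zeroʳ c
  *-distribˡ-∑ c (suc n) f = trans (*-distribˡ-+ c (∑ n f) (f n)) (cong (_+ c * f n) (*-distribˡ-∑ c n f))

  ∑-distrib-+ : ∀ n (f g : ℕ → ℕ) → ∑[ k < n ] (f k + g k) ≡ ∑ n f + ∑ n g
  ∑-distrib-+ zero    f g = refl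
  ∑-distrib-+ (suc n) f g = trans (cong (_+ (f n + g n)) (∑-distrib-+ n f g)) (interchange (∑ n f) (∑ n g) (f n) (g n))

open FiniteSums

module BinomialCoefficients where
  open import Data.Nat using (_+_; _*_; _∸_; _!; _≤_; s≤s; s<s)
  open import Data.Nat.Properties using (≤-<-connex; *-cancelʳ-≡; *-assoc; *-zeroʳ; _!*_!≢0; *-distribˡ-+; +-comm)
  open import Data.Nat.Combinatorics using (_C_; nCk≡n!/k![n-k]!; k![n∸k]!∣n!; k>n⇒nCk≡0; nCk+nC[k+1]≡[n+1]C[k+1])
  open import Data.Nat.DivMod using (_/_; m/n*n≡m)
  open import Data.Nat.Tactic.RingSolver using (solve-∀)
  open import Data.Sum using (inj₁; inj₂)

  nCk*[k!*[n∸k]!]≡n! : ∀ {n k} → k ≤ n → (n C k) * (k ! * (n ∸ k) !) ≡ n !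
  nCk*[k!*[n∸k]!]≡n! {n} {k} k≤n = begin
    (n C k) * (k ! * (n ∸ k) !)                 ≡⟨ cong (_* (k ! * (n ∸ k) !)) (nCk≡n!/k![n-k]! k≤n) ⟩
    n ! / (k ! * (n ∸ k) !) * (k ! * (n ∸ k) !) ≡⟨ m/n*n≡m (k![n∸k]!∣n! k≤n) ⟩
    n !                                         ∎
    where instance _ = k !* (n ∸ k) !≢0

  [1+k]*[1+n]C[1+k]≡[1+n]*nCk : ∀ n k → suc k * (suc n C suc k) ≡ suc n * (n C k)
  [1+k]*[1+n]C[1+k]≡[1+n]*nCk n k with ≤-<-connex k n
  ... | inj₁ k≤n = *-cancelʳ-≡ _ _ (k ! * (n ∸ k) !) (begin
    suc k * (suc n C suc k) * (k ! * (n ∸ k) !)  ≡⟨ regroup (suc k) (suc n C suc k) (k !) ((n ∸ k) !) ⟩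
    (suc n C suc k) * (suc k ! * (n ∸ k) !)      ≡⟨ nCk*[k!*[n∸k]!]≡n! (s≤s k≤n) ⟩
    suc n !                                      ≡⟨ cong (suc n *_) (nCk*[k!*[n∸k]!]≡n! k≤n) ⟨
    suc n * ((n C k) * (k ! * (n ∸ k) !))        ≡⟨ *-assoc (suc n) (n C k) _ ⟨
    suc n * (n C k) * (k ! * (n ∸ k) !)          ∎)
    where
    instance _ = k !* (n ∸ k) !≢0
    regroup : ∀ a c f g → a * c * (f * g) ≡ c * (a * f * g)
    regroup = solve-∀
  ... | inj₂ n<k = begin
    suc k * (suc n C suc k) ≡⟨ cong (suc k *_) (k>n⇒nCk≡0 (s<s n<k)) ⟩
    suc k * 0               ≡⟨ *-zeroʳ (suc k) ⟩
    0                       ≡⟨ *-zeroʳ (suc n) ⟨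
    suc n * 0               ≡⟨ cong (suc n *_) (k>n⇒nCk≡0 n<k) ⟨
    suc n * (n C k)         ∎

  [1+n]*[1+n]Ck≡k*[1+n]Ck+[1+n]*nCk : ∀ n k → suc n * (suc n C k) ≡ k * (suc n C k) + suc n * (n C k)
  [1+n]*[1+n]Ck≡k*[1+n]Ck+[1+n]*nCk n zero    = refl
  [1+n]*[1+n]Ck≡k*[1+n]Ck+[1+n]*nCk n (suc k) = begin
    suc n * (suc n C suc k)                       ≡⟨ cong (suc n *_) (nCk+nC[k+1]≡[n+1]C[k+1] n k) ⟨
    suc n * (n C k + n C suc k)                   ≡⟨ *-distribˡ-+ (suc n) (n C k) (n C suc k) ⟩
    suc n * (n C k) + suc n * (n C suc k)         ≡⟨ cong (_+ suc n * (n C suc k)) ([1+k]*[1+n]C[1+k]≡[1+n]*nCk n k) ⟨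
    suc k * (suc n C suc k) + suc n * (n C suc k) ∎

  [1+k]*nC[1+k]+k*nCk≡n*nCk : ∀ n k → suc k * (n C suc k) + k * (n C k) ≡ n * (n C k)
  [1+k]*nC[1+k]+k*nCk≡n*nCk zero    zero    = refl
  [1+k]*nC[1+k]+k*nCk≡n*nCk zero    (suc k) = cong₂ _+_ (*-zeroʳ (2 + k)) (*-zeroʳ (suc k))
  [1+k]*nC[1+k]+k*nCk≡n*nCk (suc n) k       = begin
    suc k * (suc n C suc k) + k * (suc n C k) ≡⟨ cong (_+ k * (suc n C k)) ([1+k]*[1+n]C[1+k]≡[1+n]*nCk n k) ⟩
    suc n * (n C k) + k * (suc n C k)         ≡⟨ +-comm (suc n * (n C k)) _ ⟩
    k * (suc n C k) + suc n * (n C k)         ≡⟨ [1+n]*[1+n]Ck≡k*[1+n]Ck+[1+n]*nCk n k ⟨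
    suc n * (suc n C k)                       ∎

open BinomialCoefficients

module FranelNumbers where
  open import Agda.Builtin.FromNat using (Number; fromNat)
  open import Data.Unit using (tt)
  import Data.Nat.Literals as ℕ
  import Data.Nat.Properties as ℕ
  import Data.Nat.Tactic.RingSolver as ℕ
  open import Data.Nat.Combinatorics using (_C_; nCk+nC[k+1]≡[n+1]C[k+1]; k>n⇒nCk≡0)
  open import Data.Integer using (ℤ; +_; _+_; _*_; _-_; 0ℤ)
  open import Data.Integer.Properties using (*-cancelˡ-≡; pos-+; pos-*; +-injective; +-identityʳ; +-assoc)
  import Data.Integer.Literals as ℤ
  open import Data.Integer.Tactic.RingSolver using (solve-∀)

  instance
    ℕ-number : Number ℕ
    ℕ-number = ℕ.number
    ℤ-number : Number ℤ
    ℤ-number = ℤ.number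

  franel : ℕ → ℕ
  franel n = ∑[ k < suc n ] (n C k) ℕ.^ 3

  cube : ℤ → ℤ
  cube x = x * x * x

  -- Creative-telescoping certificate R(N, k): with G(k) = C(N, k − 1)³ · R(N, k), N times the
  -- summand (N+1)² C(N+1,k)³ − (7N² + 7N + 2) C(N,k)³ − 8N² C(N−1,k)³ equals G(k + 1) − G(k).
  certificate : ℤ → ℤ → ℤ
  certificate N k = 4 * k * k * k - (12 + 18 * N) * k * k + (12 + 39 * N + 27 * N * N) * k
                    - (4 + 22 * N + 32 * N * N + 14 * N * N * N)

  x+y≡z⇒x≡z-y : ∀ {x y z : ℤ} → x + y ≡ z → x ≡ z - y
  x+y≡z⇒x≡z-y {x} {y} refl = x≡[x+y]-y x y
    where
    x≡[x+y]-y : ∀ x y → x ≡ (x + y) - y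
    x≡[x+y]-y = solve-∀

  certificate-identity₀ : ∀ N →
    N * ((1 + N) * (1 + N)) * cube 1 + 0
      ≡ N * (7 * N * N + 7 * N + 2) * cube 1 + N * (8 * N * N) * cube 1 + cube 1 * certificate N 1
  certificate-identity₀ = expanded
    where
    expanded : ∀ N → N * ((1 + N) * (1 + N)) * (1 * 1 * 1) + 0
      ≡ N * (7 * N * N + 7 * N + 2) * (1 * 1 * 1) + N * (8 * N * N) * (1 * 1 * 1)
        + 1 * 1 * 1 * (4 * 1 * 1 * 1 - (12 + 18 * N) * 1 * 1 + (12 + 39 * N + 27 * N * N) * 1
                       - (4 + 22 * N + 32 * N * N + 14 * N * N * N))
    expanded = solve-∀

  -- Multiplied by (1 + k)³, both sides become polynomials in (1+k)X, (1+k)Y and (1+k)NZ, which the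
  -- two hypotheses turn into X³ times polynomials in N and k.
  certificate-identity : ∀ (N : ℤ) (k : ℕ) (X Y Z : ℤ) → let K = + k in
    (1 + K) * Y + K * X ≡ N * X →
    N * Z + (1 + K) * Y ≡ N * Y →
    N * ((1 + N) * (1 + N)) * cube (X + Y) + cube X * certificate N (1 + K)
      ≡ N * (7 * N * N + 7 * N + 2) * cube Y + N * (8 * N * N) * cube Z + cube Y * certificate N (2 + K)
  certificate-identity N k X Y Z hY hZ = *-cancelˡ-≡ (cube (1 + K)) lhs rhs (begin
      cube (1 + K) * lhs                              ≡⟨ scale-lhs (1 + K) (N * ((1 + N) * (1 + N))) (certificate N (1 + K)) X Y ⟩
      Φ ((1 + K) * X) ((1 + K) * Y)                   ≡⟨ cong (Φ ((1 + K) * X)) aY≡[N-K]X ⟩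
      Φ ((1 + K) * X) ((N - K) * X)                   ≡⟨ substituted N K X ⟩
      Ψ ((N - K) * X) ((N - K - 1) * ((N - K) * X))   ≡⟨ cong₂ Ψ aY≡[N-K]X aNZ≡[N-K-1][N-K]X ⟨
      Ψ ((1 + K) * Y) ((1 + K) * (N * Z))             ≡⟨ scale-rhs (1 + K) (N * (7 * N * N + 7 * N + 2)) (certificate N (2 + K)) N Y Z ⟨
      cube (1 + K) * rhs                              ∎)
    where
    K = + k
    lhs = N * ((1 + N) * (1 + N)) * cube (X + Y) + cube X * certificate N (1 + K)
    rhs = N * (7 * N * N + 7 * N + 2) * cube Y + N * (8 * N * N) * cube Z + cube Y * certificate N (2 + K)
    Φ : ℤ → ℤ → ℤ
    Φ aX aY = N * ((1 + N) * (1 + N)) * cube (aX + aY) + cube aX * certificate N (1 + K)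
    Ψ : ℤ → ℤ → ℤ
    Ψ aY aNZ = N * (7 * N * N + 7 * N + 2) * cube aY + 8 * cube aNZ + cube aY * certificate N (2 + K)
    aY≡[N-K]X : (1 + K) * Y ≡ (N - K) * X
    aY≡[N-K]X = trans (x+y≡z⇒x≡z-y hY) (factor N K X)
      where
      factor : ∀ N K X → N * X - K * X ≡ (N - K) * X
      factor = solve-∀
    aNZ≡[N-K-1][N-K]X : (1 + K) * (N * Z) ≡ (N - K - 1) * ((N - K) * X)
    aNZ≡[N-K-1][N-K]X = begin
      (1 + K) * (N * Z)               ≡⟨ cong ((1 + K) *_) (x+y≡z⇒x≡z-y hZ) ⟩
      (1 + K) * (N * Y - (1 + K) * Y) ≡⟨ regroup N K Y ⟩
      (N - K - 1) * ((1 + K) * Y)     ≡⟨ cong ((N - K - 1) *_) aY≡[N-K]X ⟩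
      (N - K - 1) * ((N - K) * X)     ∎
      where
      regroup : ∀ N K Y → (1 + K) * (N * Y - (1 + K) * Y) ≡ (N - K - 1) * ((1 + K) * Y)
      regroup = solve-∀
    scale-lhs : ∀ a b c X Y → a * a * a * (b * ((X + Y) * (X + Y) * (X + Y)) + X * X * X * c)
      ≡ b * ((a * X + a * Y) * (a * X + a * Y) * (a * X + a * Y)) + (a * X) * (a * X) * (a * X) * c
    scale-lhs = solve-∀
    scale-rhs : ∀ a b c N Y Z → a * a * a * (b * (Y * Y * Y) + N * (8 * N * N) * (Z * Z * Z) + Y * Y * Y * c)
      ≡ b * ((a * Y) * (a * Y) * (a * Y)) + 8 * ((a * (N * Z)) * (a * (N * Z)) * (a * (N * Z))) + (a * Y) * (a * Y) * (a * Y) * c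
    scale-rhs = solve-∀
    substituted : ∀ N K X → let V = (N - K) * X in
      N * ((1 + N) * (1 + N)) * (((1 + K) * X + V) * ((1 + K) * X + V) * ((1 + K) * X + V))
        + ((1 + K) * X) * ((1 + K) * X) * ((1 + K) * X)
          * (4 * (1 + K) * (1 + K) * (1 + K) - (12 + 18 * N) * (1 + K) * (1 + K) + (12 + 39 * N + 27 * N * N) * (1 + K)
             - (4 + 22 * N + 32 * N * N + 14 * N * N * N))
      ≡ N * (7 * N * N + 7 * N + 2) * (V * V * V) + 8 * (((N - K - 1) * V) * ((N - K - 1) * V) * ((N - K - 1) * V))
        + V * V * V
          * (4 * (2 + K) * (2 + K) * (2 + K) - (12 + 18 * N) * (2 + K) * (2 + K) + (12 + 39 * N + 27 * N * N) * (2 + K)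
             - (4 + 22 * N + 32 * N * N + 14 * N * N * N))
    substituted = solve-∀

  pos-cube : ∀ m → + (m ℕ.^ 3) ≡ cube (+ m)
  pos-cube m = begin
    + (m ℕ.* (m ℕ.* (m ℕ.* 1))) ≡⟨ pos-* m _ ⟩
    + m * + (m ℕ.* (m ℕ.* 1))   ≡⟨ cong (+ m *_) (pos-* m _) ⟩
    + m * (+ m * + (m ℕ.* 1))   ≡⟨ cong (λ x → + m * (+ m * x)) (pos-* m 1) ⟩
    + m * (+ m * (+ m * 1))     ≡⟨ reassoc (+ m) ⟩
    cube (+ m)                  ∎
    where
    reassoc : ∀ x → x * (x * (x * 1)) ≡ x * x * x
    reassoc = solve-∀

  pos-*-* : ∀ a b c → + (a ℕ.* b ℕ.* c) ≡ + a * + b * + c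
  pos-*-* a b c = trans (pos-* (a ℕ.* b) c) (cong (_* + c) (pos-* a b))

  pos-*-+-* : ∀ a b c d → + (a ℕ.* b ℕ.+ c ℕ.* d) ≡ + a * + b + + c * + d
  pos-*-+-* a b c d = trans (pos-+ (a ℕ.* b) (c ℕ.* d)) (cong₂ _+_ (pos-* a b) (pos-* c d))

  pos-*-*-^3 : ∀ a b c → + (a ℕ.* b ℕ.* c ℕ.^ 3) ≡ + a * + b * cube (+ c)
  pos-*-*-^3 a b c = trans (pos-* (a ℕ.* b) (c ℕ.^ 3)) (cong₂ _*_ (pos-* a b) (pos-cube c))

  pos-quadratic : ∀ N → + (7 ℕ.* N ℕ.* N ℕ.+ 7 ℕ.* N ℕ.+ 2) ≡ 7 * + N * + N + 7 * + N + 2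
  pos-quadratic N = begin
    + (7 ℕ.* N ℕ.* N ℕ.+ 7 ℕ.* N ℕ.+ 2) ≡⟨ pos-+ (7 ℕ.* N ℕ.* N ℕ.+ 7 ℕ.* N) 2 ⟩
    + (7 ℕ.* N ℕ.* N ℕ.+ 7 ℕ.* N) + 2   ≡⟨ cong (_+ 2) (pos-+ (7 ℕ.* N ℕ.* N) (7 ℕ.* N)) ⟩
    + (7 ℕ.* N ℕ.* N) + + (7 ℕ.* N) + 2 ≡⟨ cong₂ (λ x y → x + y + 2) (pos-*-* 7 N N) (pos-* 7 N) ⟩
    7 * + N * + N + 7 * + N + 2         ∎

  pos-franel-lhs : ∀ N c → + (N ℕ.* ((1 ℕ.+ N) ℕ.* (1 ℕ.+ N)) ℕ.* c ℕ.^ 3) ≡ + N * ((1 + + N) * (1 + + N)) * cube (+ c)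
  pos-franel-lhs N c = trans (pos-*-*-^3 N ((1 ℕ.+ N) ℕ.* (1 ℕ.+ N)) c)
                             (cong (λ x → + N * x * cube (+ c)) (pos-* (1 ℕ.+ N) (1 ℕ.+ N)))

  pos-franel-rhs : ∀ N c d →
    + (N ℕ.* (7 ℕ.* N ℕ.* N ℕ.+ 7 ℕ.* N ℕ.+ 2) ℕ.* c ℕ.^ 3 ℕ.+ N ℕ.* (8 ℕ.* N ℕ.* N) ℕ.* d ℕ.^ 3)
      ≡ + N * (7 * + N * + N + 7 * + N + 2) * cube (+ c) + + N * (8 * + N * + N) * cube (+ d)
  pos-franel-rhs N c d = trans (pos-+ (N ℕ.* q ℕ.* c ℕ.^ 3) (N ℕ.* (8 ℕ.* N ℕ.* N) ℕ.* d ℕ.^ 3)) (cong₂ _+_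
    (trans (pos-*-*-^3 N q c) (cong (λ x → + N * x * cube (+ c)) (pos-quadratic N)))
    (trans (pos-*-*-^3 N (8 ℕ.* N ℕ.* N) d) (cong (λ x → + N * x * cube (+ d)) (pos-*-* 8 N N))))
    where q = 7 ℕ.* N ℕ.* N ℕ.+ 7 ℕ.* N ℕ.+ 2

  ∑-telescope : (a b : ℕ → ℕ) (g : ℕ → ℤ) → (∀ k → + a k + g k ≡ + b k + g (suc k)) →
                ∀ n → + ∑ n a + g 0 ≡ + ∑ n b + g n
  ∑-telescope a b g step zero    = refl
  ∑-telescope a b g step (suc n) = begin
    + (∑ n a ℕ.+ a n) + g 0       ≡⟨ cong (_+ g 0) (pos-+ (∑ n a) (a n)) ⟩
    + ∑ n a + + a n + g 0         ≡⟨ swap (+ ∑ n a) (+ a n) (g 0) ⟩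
    + ∑ n a + g 0 + + a n         ≡⟨ cong (_+ + a n) (∑-telescope a b g step n) ⟩
    + ∑ n b + g n + + a n         ≡⟨ swap (+ ∑ n b) (g n) (+ a n) ⟩
    + ∑ n b + + a n + g n         ≡⟨ +-assoc (+ ∑ n b) (+ a n) (g n) ⟩
    + ∑ n b + (+ a n + g n)       ≡⟨ cong (λ x → + ∑ n b + x) (step n) ⟩
    + ∑ n b + (+ b n + g (suc n)) ≡⟨ +-assoc (+ ∑ n b) (+ b n) (g (suc n)) ⟨
    + ∑ n b + + b n + g (suc n)   ≡⟨ cong (_+ g (suc n)) (pos-+ (∑ n b) (b n)) ⟨
    + (∑ n b ℕ.+ b n) + g (suc n) ∎
    where
    swap : ∀ x y z → x + y + z ≡ x + z + y
    swap = solve-∀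

  telescoper : ℕ → ℕ → ℤ
  telescoper N zero    = 0ℤ
  telescoper N (suc k) = cube (+ (N C k)) * certificate (+ N) (+ suc k)

  franel-creative-telescoping : ∀ n k → let N = suc n in
    + (N ℕ.* ((1 ℕ.+ N) ℕ.* (1 ℕ.+ N)) ℕ.* ((1 ℕ.+ N) C k) ℕ.^ 3) + telescoper N k
      ≡ + (N ℕ.* (7 ℕ.* N ℕ.* N ℕ.+ 7 ℕ.* N ℕ.+ 2) ℕ.* (N C k) ℕ.^ 3 ℕ.+ N ℕ.* (8 ℕ.* N ℕ.* N) ℕ.* (n C k) ℕ.^ 3)
        + telescoper N (suc k)
  franel-creative-telescoping n zero = begin
    + (N ℕ.* M ℕ.* 1) + 0ℤ
      ≡⟨ cong (_+ 0ℤ) (pos-franel-lhs N 1) ⟩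
    + N * ((1 + + N) * (1 + + N)) * cube 1 + 0
      ≡⟨ certificate-identity₀ (+ N) ⟩
    + N * (7 * + N * + N + 7 * + N + 2) * cube 1 + + N * (8 * + N * + N) * cube 1 + telescoper N 1
      ≡⟨ cong (_+ telescoper N 1) (pos-franel-rhs N 1 1) ⟨
    + (N ℕ.* (7 ℕ.* N ℕ.* N ℕ.+ 7 ℕ.* N ℕ.+ 2) ℕ.* 1 ℕ.+ N ℕ.* (8 ℕ.* N ℕ.* N) ℕ.* 1) + telescoper N 1
      ∎
    where
    N = suc n
    M = (1 ℕ.+ N) ℕ.* (1 ℕ.+ N)
  franel-creative-telescoping n (suc k) = begin
    + (N ℕ.* M ℕ.* ((1 ℕ.+ N) C suc k) ℕ.^ 3) + telescoper N (suc k)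
      ≡⟨ cong (λ c → + (N ℕ.* M ℕ.* c ℕ.^ 3) + telescoper N (suc k)) (nCk+nC[k+1]≡[n+1]C[k+1] N k) ⟨
    + (N ℕ.* M ℕ.* (X ℕ.+ Y) ℕ.^ 3) + telescoper N (suc k)
      ≡⟨ cong (_+ telescoper N (suc k)) (pos-franel-lhs N (X ℕ.+ Y)) ⟩
    + N * ((1 + + N) * (1 + + N)) * cube (+ X + + Y) + telescoper N (suc k)
      ≡⟨ certificate-identity (+ N) k (+ X) (+ Y) (+ Z) hY hZ ⟩
    + N * (7 * + N * + N + 7 * + N + 2) * cube (+ Y) + + N * (8 * + N * + N) * cube (+ Z) + telescoper N (2 ℕ.+ k)
      ≡⟨ cong (_+ telescoper N (2 ℕ.+ k)) (pos-franel-rhs N Y Z) ⟨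
    + (N ℕ.* (7 ℕ.* N ℕ.* N ℕ.+ 7 ℕ.* N ℕ.+ 2) ℕ.* Y ℕ.^ 3 ℕ.+ N ℕ.* (8 ℕ.* N ℕ.* N) ℕ.* Z ℕ.^ 3)
      + telescoper N (2 ℕ.+ k)
      ∎
    where
    N = suc n
    M = (1 ℕ.+ N) ℕ.* (1 ℕ.+ N)
    X = N C k
    Y = N C suc k
    Z = n C suc k
    hY : + suc k * + Y + + k * + X ≡ + N * + X
    hY = trans (sym (pos-*-+-* (suc k) Y k X)) (trans (cong +_ ([1+k]*nC[1+k]+k*nCk≡n*nCk N k)) (pos-* N X))
    hZ : + N * + Z + + suc k * + Y ≡ + N * + Y
    hZ = trans (sym (pos-*-+-* N Z (suc k) Y))
           (trans (cong +_ (trans (ℕ.+-comm (N ℕ.* Z) _) (sym ([1+n]*[1+n]Ck≡k*[1+n]Ck+[1+n]*nCk n (suc k)))))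
                  (pos-* N Y))

  ∑-C^3-beyond : ∀ d n → ∑[ k < d ℕ.+ suc n ] (n C k) ℕ.^ 3 ≡ franel n
  ∑-C^3-beyond zero    n = refl
  ∑-C^3-beyond (suc d) n = begin
    (∑[ k < d ℕ.+ suc n ] (n C k) ℕ.^ 3) ℕ.+ (n C (d ℕ.+ suc n)) ℕ.^ 3
      ≡⟨ cong (λ c → (∑[ k < d ℕ.+ suc n ] (n C k) ℕ.^ 3) ℕ.+ c ℕ.^ 3) (k>n⇒nCk≡0 (ℕ.m≤n+m (suc n) d)) ⟩
    (∑[ k < d ℕ.+ suc n ] (n C k) ℕ.^ 3) ℕ.+ 0 ≡⟨ ℕ.+-identityʳ _ ⟩
    ∑[ k < d ℕ.+ suc n ] (n C k) ℕ.^ 3         ≡⟨ ∑-C^3-beyond d n ⟩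
    franel n                                   ∎

  franel-recurrence : ∀ n → let N = suc n in
    (1 ℕ.+ N) ℕ.* (1 ℕ.+ N) ℕ.* franel (1 ℕ.+ N)
      ≡ (7 ℕ.* N ℕ.* N ℕ.+ 7 ℕ.* N ℕ.+ 2) ℕ.* franel N ℕ.+ 8 ℕ.* N ℕ.* N ℕ.* franel n
  franel-recurrence n = ℕ.*-cancelˡ-≡ _ _ N (begin
    N ℕ.* (M ℕ.* franel (1 ℕ.+ N))                        ≡⟨ ℕ.*-assoc N M (franel (1 ℕ.+ N)) ⟨
    N ℕ.* M ℕ.* franel (1 ℕ.+ N)                          ≡⟨ *-distribˡ-∑ (N ℕ.* M) K (λ k → ((1 ℕ.+ N) C k) ℕ.^ 3) ⟩
    ∑ K a                                                 ≡⟨ ∑a≡∑b ⟩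
    ∑ K b
      ≡⟨ ∑-distrib-+ K (λ k → N ℕ.* q ℕ.* (N C k) ℕ.^ 3) (λ k → N ℕ.* 8NN ℕ.* (n C k) ℕ.^ 3) ⟩
    (∑[ k < K ] N ℕ.* q ℕ.* (N C k) ℕ.^ 3) ℕ.+ (∑[ k < K ] N ℕ.* 8NN ℕ.* (n C k) ℕ.^ 3)
      ≡⟨ cong₂ ℕ._+_ (*-distribˡ-∑ (N ℕ.* q) K (λ k → (N C k) ℕ.^ 3))
                     (*-distribˡ-∑ (N ℕ.* 8NN) K (λ k → (n C k) ℕ.^ 3)) ⟨
    N ℕ.* q ℕ.* (∑[ k < K ] (N C k) ℕ.^ 3) ℕ.+ N ℕ.* 8NN ℕ.* (∑[ k < K ] (n C k) ℕ.^ 3)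
      ≡⟨ cong₂ (λ x y → N ℕ.* q ℕ.* x ℕ.+ N ℕ.* 8NN ℕ.* y) (∑-C^3-beyond 1 N) (∑-C^3-beyond 2 n) ⟩
    N ℕ.* q ℕ.* franel N ℕ.+ N ℕ.* 8NN ℕ.* franel n       ≡⟨ factor-N N q 8NN (franel N) (franel n) ⟩
    N ℕ.* (q ℕ.* franel N ℕ.+ 8NN ℕ.* franel n)           ∎)
    where
    N = suc n
    M = (1 ℕ.+ N) ℕ.* (1 ℕ.+ N)
    q = 7 ℕ.* N ℕ.* N ℕ.+ 7 ℕ.* N ℕ.+ 2
    8NN = 8 ℕ.* N ℕ.* N
    K = 2 ℕ.+ N
    a b : ℕ → ℕ
    a k = N ℕ.* M ℕ.* ((1 ℕ.+ N) C k) ℕ.^ 3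
    b k = N ℕ.* q ℕ.* (N C k) ℕ.^ 3 ℕ.+ N ℕ.* 8NN ℕ.* (n C k) ℕ.^ 3
    telescoper-vanishes : telescoper N K ≡ 0ℤ
    telescoper-vanishes rewrite k>n⇒nCk≡0 (ℕ.n<1+n N) = refl
    ∑a≡∑b : ∑ K a ≡ ∑ K b
    ∑a≡∑b = +-injective (begin
      + ∑ K a                 ≡⟨ +-identityʳ (+ ∑ K a) ⟨
      + ∑ K a + 0ℤ            ≡⟨ ∑-telescope a b (telescoper N) (franel-creative-telescoping n) K ⟩
      + ∑ K b + telescoper N K ≡⟨ cong (λ x → + ∑ K b + x) telescoper-vanishes ⟩
      + ∑ K b + 0ℤ            ≡⟨ +-identityʳ (+ ∑ K b) ⟩
      + ∑ K b                 ∎)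
    factor-N : ∀ N q e x y → N ℕ.* q ℕ.* x ℕ.+ N ℕ.* e ℕ.* y ≡ N ℕ.* (q ℕ.* x ℕ.+ e ℕ.* y)
    factor-N = ℕ.solve-∀

open FranelNumbers using (franel; franel-recurrence)

open import Data.Nat using (_+_; _*_; _∸_; _^_; _!; _≤_; _>_; _/_; pred)
open import Data.Nat.Properties as ℕ using ()
open import Data.Nat.Combinatorics using (_C_)
open import Data.Nat.DivMod using (m/n*n≡m)
open import Data.Nat.Divisibility using (divides)
open import Data.Nat.ListAction using (sum)
open import Data.Nat.ListAction.Properties using (sum-++)
open import Data.Nat.Tactic.RingSolver using (solve-∀)
open import Data.Bool using (Bool; true; false; T; T?; _∧_; if_then_else_)
open import Data.Bool.Properties using (T-∧)
open import Data.Bool.ListAction using (and)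
open import Data.Fin using (Fin) renaming (zero to fzero; suc to fsuc)
open import Data.Fin.Properties using () renaming (_≟_ to _≟ᶠ_)
open import Data.List as List using (List; []; _∷_; map; concatMap; filterᵇ; length; allFin)
import Data.List.Properties as List
open import Data.List.Relation.Unary.All as All using (All; []; _∷_)
open import Data.List.Relation.Unary.All.Properties using (map⁺; map⁻; tabulate⁺)
open import Data.List.Membership.Propositional.Properties using (∈-allFin)
open import Data.Vec as Vec using (Vec; []; _∷_; lookup; updateAt; replicate; tabulate)
import Data.Vec.Properties as Vec
open import Data.Product using (_×_; _,_)
open import Data.Unit using (tt)
open import Function using (_∘_; id)
open import Function.Bundles using (_⇔_; mk⇔; Equivalence)
import Function.Properties.Equivalence as ⇔
open import Relation.Nullary using (Dec; does; yes; no; _×-dec_)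
open import Relation.Nullary.Decidable using (⌊_⌋; does-⇔; dec-true; dec-false)
open import Algebra.Properties.CommutativeSemigroup ℕ.+-commutativeSemigroup
  using () renaming (interchange to +-interchange; x∙yz≈y∙xz to x+[y+z]≡y+[x+z])
open import Algebra.Properties.CommutativeSemigroup ℕ.*-commutativeSemigroup
  using () renaming (x∙yz≈y∙xz to x*[y*z]≡y*[x*z])

𝟙 : Bool → ℕ
𝟙 b = if b then 1 else 0

length-filterᵇ : ∀ {A : Set} (p : A → Bool) xs → length (filterᵇ p xs) ≡ sum (map (𝟙 ∘ p) xs)
length-filterᵇ p []       = refl
length-filterᵇ p (x ∷ xs) with p x
... | true  = cong suc (length-filterᵇ p xs)
... | false = length-filterᵇ p xs

sum-map-cong : ∀ {A : Set} {f g : A → ℕ} → (∀ x → f x ≡ g x) → ∀ xs → sum (map f xs) ≡ sum (map g xs)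
sum-map-cong f≗g xs = cong sum (List.map-cong f≗g xs)

sum-map-≡0 : ∀ {A : Set} {f : A → ℕ} → (∀ x → f x ≡ 0) → ∀ xs → sum (map f xs) ≡ 0
sum-map-≡0 f≗0 []       = refl
sum-map-≡0 f≗0 (x ∷ xs) = cong₂ _+_ (f≗0 x) (sum-map-≡0 f≗0 xs)

sum-map-+ : ∀ {A : Set} (f g : A → ℕ) xs → sum (map (λ x → f x + g x) xs) ≡ sum (map f xs) + sum (map g xs)
sum-map-+ f g []       = refl
sum-map-+ f g (x ∷ xs) = trans (cong (f x + g x +_) (sum-map-+ f g xs)) (+-interchange (f x) (g x) _ _)

sum-map-*ʳ : ∀ {A : Set} (f : A → ℕ) c xs → sum (map f xs) * c ≡ sum (map (λ x → f x * c) xs)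
sum-map-*ʳ f c []       = refl
sum-map-*ʳ f c (x ∷ xs) = trans (ℕ.*-distribʳ-+ c (f x) (sum (map f xs))) (cong (f x * c +_) (sum-map-*ʳ f c xs))

sum-map-∑ : ∀ {A : Set} n (f : A → ℕ → ℕ) xs → sum (map (λ x → ∑[ t < n ] f x t) xs) ≡ ∑[ t < n ] sum (map (λ x → f x t) xs)
sum-map-∑ zero    f xs = sum-map-≡0 (λ _ → refl) xs
sum-map-∑ (suc n) f xs = trans (sum-map-+ (λ x → ∑[ t < n ] f x t) (λ x → f x n) xs)
                               (cong (_+ sum (map (λ x → f x n) xs)) (sum-map-∑ n f xs))

sum-map-concatMap : ∀ {A B : Set} (f : B → ℕ) (g : A → List B) xs →
                    sum (map f (concatMap g xs)) ≡ sum (map (λ x → sum (map f (g x))) xs)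
sum-map-concatMap f g []       = refl
sum-map-concatMap f g (x ∷ xs) = begin
  sum (map f (g x List.++ concatMap g xs))                   ≡⟨ cong sum (List.map-++ f (g x) (concatMap g xs)) ⟩
  sum (map f (g x) List.++ map f (concatMap g xs))           ≡⟨ sum-++ (map f (g x)) _ ⟩
  sum (map f (g x)) + sum (map f (concatMap g xs))           ≡⟨ cong (sum (map f (g x)) +_) (sum-map-concatMap f g xs) ⟩
  sum (map f (g x)) + sum (map (λ x → sum (map f (g x))) xs) ∎

sum-map-lookup-allFin : ∀ {k} (c : Vec ℕ k) → sum (map (lookup c) (allFin k)) ≡ Vec.sum c
sum-map-lookup-allFin []      = refl
sum-map-lookup-allFin (a ∷ c) = cong (a +_) (begin
  sum (map (lookup (a ∷ c)) (List.tabulate fsuc)) ≡⟨ cong sum (List.map-tabulate fsuc (lookup (a ∷ c))) ⟩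
  sum (List.tabulate (lookup c))                  ≡⟨ cong sum (List.map-tabulate id (lookup c)) ⟨
  sum (map (lookup c) (allFin _))                 ≡⟨ sum-map-lookup-allFin c ⟩
  Vec.sum c                                       ∎)

sequences : ∀ {A : Set} → List A → ℕ → List (List A)
sequences xs zero    = [] ∷ []
sequences xs (suc n) = concatMap (λ x → map (x ∷_) (sequences xs n)) xs

map-sequences : ∀ {A B : Set} (f : A → B) xs n → map (map f) (sequences xs n) ≡ sequences (map f xs) n
map-sequences f xs zero    = refl
map-sequences f xs (suc n) = begin
  map (map f) (concatMap (λ x → map (x ∷_) (sequences xs n)) xs)
    ≡⟨ List.map-concatMap (map f) _ xs ⟩
  concatMap (λ x → map (map f) (map (x ∷_) (sequences xs n))) xs
    ≡⟨ List.concatMap-cong (λ x → trans (sym (List.map-∘ _)) (List.map-∘ _)) xs ⟩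
  concatMap (λ x → map (f x ∷_) (map (map f) (sequences xs n))) xs
    ≡⟨ List.concatMap-cong (λ x → cong (map (f x ∷_)) (map-sequences f xs n)) xs ⟩
  concatMap (λ x → map (f x ∷_) (sequences (map f xs) n)) xs
    ≡⟨ List.concatMap-map (λ y → map (y ∷_) (sequences (map f xs) n)) f xs ⟨
  sequences (map f xs) (suc n)
    ∎

letterCounts : ∀ {k} → List (Fin k) → Vec ℕ k
letterCounts []      = replicate _ 0
letterCounts (x ∷ w) = updateAt (letterCounts w) x suc

_≟ᵛ_ : ∀ {k} (c d : Vec ℕ k) → Dec (c ≡ d)
_≟ᵛ_ = Vec.≡-dec ℕ._≟_

#words : ∀ {k} → ℕ → Vec ℕ k → ℕ
#words {k} n c = sum (map (λ w → 𝟙 (does (letterCounts w ≟ᵛ c))) (sequences (allFin k) n))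

∏! : ∀ {k} → Vec ℕ k → ℕ
∏! []      = 1
∏! (a ∷ c) = a ! * ∏! c

sum≡0⇒≡replicate : ∀ {k} (c : Vec ℕ k) → Vec.sum c ≡ 0 → c ≡ replicate k 0
sum≡0⇒≡replicate []      _   = refl
sum≡0⇒≡replicate (a ∷ c) Σ≡0 = cong₂ _∷_ (ℕ.m+n≡0⇒m≡0 a Σ≡0) (sum≡0⇒≡replicate c (ℕ.m+n≡0⇒n≡0 a Σ≡0))

∏!-replicate-0 : ∀ k → ∏! (replicate k 0) ≡ 1
∏!-replicate-0 zero    = refl
∏!-replicate-0 (suc k) = trans (ℕ.*-identityˡ _) (∏!-replicate-0 k)

∏!-pred : ∀ {k} (x : Fin k) (c : Vec ℕ k) {r} → lookup c x ≡ suc r → ∏! c ≡ suc r * ∏! (updateAt c x pred)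
∏!-pred fzero    (.(suc r) ∷ c) {r} refl = ℕ.*-assoc (suc r) (r !) (∏! c)
∏!-pred (fsuc x) (a ∷ c)        {r} cₓ≡  = trans (cong (a ! *_) (∏!-pred x c cₓ≡)) (x*[y*z]≡y*[x*z] (a !) (suc r) _)

sum-pred : ∀ {k} (x : Fin k) (c : Vec ℕ k) {r} → lookup c x ≡ suc r → Vec.sum c ≡ suc (Vec.sum (updateAt c x pred))
sum-pred fzero    (.(suc r) ∷ c) {r} refl = refl
sum-pred (fsuc x) (a ∷ c)        cₓ≡      = trans (cong (a +_) (sum-pred x c cₓ≡)) (ℕ.+-suc a _)

updateAt-suc≡⇔ : ∀ {k} (x : Fin k) (c d : Vec ℕ k) {r} → lookup c x ≡ suc r →
                 (updateAt d x suc ≡ c) ⇔ (d ≡ updateAt c x pred)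
updateAt-suc≡⇔ x c d cₓ≡ = mk⇔
  (λ { refl → sym (trans (Vec.updateAt-updateAt x d) (Vec.updateAt-id x d)) })
  (λ { refl → trans (Vec.updateAt-updateAt x c) (Vec.updateAt-id-local x c (trans (cong (suc ∘ pred) cₓ≡) (sym cₓ≡))) })

first-letter-count*∏! : ∀ {k} n (c : Vec ℕ k) x →
  (∀ c′ → Vec.sum c′ ≡ n → #words n c′ * ∏! c′ ≡ n !) → Vec.sum c ≡ suc n →
  sum (map (λ w → 𝟙 (does (letterCounts (x ∷ w) ≟ᵛ c))) (sequences (allFin k) n)) * ∏! c ≡ lookup c x * n !
first-letter-count*∏! {k} n c x #words*∏!≡n! Σc≡1+n with lookup c x in cₓ≡
... | zero  = cong (_* ∏! c) (sum-map-≡0 (λ w → cong 𝟙 (dec-false (updateAt (letterCounts w) x suc ≟ᵛ c) (cₓ≢0 w))) W)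
  where
  W = sequences (allFin k) n
  cₓ≢0 : ∀ w → updateAt (letterCounts w) x suc ≢ c
  cₓ≢0 w refl = ℕ.0≢1+n (trans (sym cₓ≡) (Vec.lookup∘updateAt x (letterCounts w)))
... | suc r = begin
  sum (map (λ w → 𝟙 (does (letterCounts (x ∷ w) ≟ᵛ c))) W) * ∏! c
    ≡⟨ cong₂ _*_ (sum-map-cong drop-first-letter W) (∏!-pred x c cₓ≡) ⟩
  #words n c′ * (suc r * ∏! c′)
    ≡⟨ x*[y*z]≡y*[x*z] (#words n c′) (suc r) (∏! c′) ⟩
  suc r * (#words n c′ * ∏! c′)
    ≡⟨ cong (suc r *_) (#words*∏!≡n! c′ (ℕ.suc-injective (trans (sym (sum-pred x c cₓ≡)) Σc≡1+n))) ⟩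
  suc r * n !
    ∎
  where
  W = sequences (allFin k) n
  c′ = updateAt c x pred
  drop-first-letter : ∀ w → 𝟙 (does (letterCounts (x ∷ w) ≟ᵛ c)) ≡ 𝟙 (does (letterCounts w ≟ᵛ c′))
  drop-first-letter w = cong 𝟙 (does-⇔ (updateAt-suc≡⇔ x c (letterCounts w) cₓ≡)
                                       (updateAt (letterCounts w) x suc ≟ᵛ c) (letterCounts w ≟ᵛ c′))

#words*∏!≡n! : ∀ {k} n (c : Vec ℕ k) → Vec.sum c ≡ n → #words n c * ∏! c ≡ n !
#words*∏!≡n! {k} zero c Σc≡0 with sum≡0⇒≡replicate c Σc≡0
... | refl rewrite dec-true (replicate k 0 ≟ᵛ replicate k 0) refl | ∏!-replicate-0 k = refl
#words*∏!≡n! {k} (suc n) c Σc≡1+n = begin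
  #words (suc n) c * ∏! c
    ≡⟨ cong (_* ∏! c) (sum-map-concatMap counted (λ x → map (x ∷_) W) (allFin k)) ⟩
  sum (map (λ x → sum (map counted (map (x ∷_) W))) (allFin k)) * ∏! c
    ≡⟨ cong (_* ∏! c) (sum-map-cong (λ x → cong sum (sym (List.map-∘ W))) (allFin k)) ⟩
  sum (map (λ x → sum (map (counted ∘ (x ∷_)) W)) (allFin k)) * ∏! c
    ≡⟨ sum-map-*ʳ _ (∏! c) (allFin k) ⟩
  sum (map (λ x → sum (map (counted ∘ (x ∷_)) W) * ∏! c) (allFin k))
    ≡⟨ sum-map-cong (λ x → first-letter-count*∏! n c x (#words*∏!≡n! n) Σc≡1+n) (allFin k) ⟩
  sum (map (λ x → lookup c x * n !) (allFin k))
    ≡⟨ sum-map-*ʳ (lookup c) (n !) (allFin k) ⟨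
  sum (map (lookup c) (allFin k)) * n !
    ≡⟨ cong (_* n !) (trans (sum-map-lookup-allFin c) Σc≡1+n) ⟩
  suc n * n !
    ∎
  where
  W = sequences (allFin k) n
  counted : List (Fin k) → ℕ
  counted w = 𝟙 (does (letterCounts w ≟ᵛ c))

letter : Fin 6 → Mat
letter x = permMat (List.lookup perms x)

steps≡sequences : ∀ n → steps n ≡ sequences (map permMat perms) n
steps≡sequences zero    = refl
steps≡sequences (suc n) = begin
  concatMap (λ σ → map (permMat σ ∷_) (steps n)) perms
    ≡⟨ List.concatMap-cong (λ σ → cong (map (permMat σ ∷_)) (steps≡sequences n)) perms ⟩
  concatMap (λ σ → map (permMat σ ∷_) (sequences (map permMat perms) n)) perms
    ≡⟨ List.concatMap-map (λ P → map (P ∷_) (sequences (map permMat perms) n)) permMat perms ⟨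
  sequences (map permMat perms) (suc n)
    ∎

steps≡map-letter : ∀ n → steps n ≡ map (map letter) (sequences (allFin 6) n)
steps≡map-letter n = trans (steps≡sequences n) (sym (map-sequences letter (allFin 6) n))

select : ∀ {k} → Vec ℕ k → Vec Bool k → ℕ
select []      []          = 0
select (a ∷ d) (true  ∷ m) = a + select d m
select (a ∷ d) (false ∷ m) = select d m

select-replicate-0 : ∀ {k} (m : Vec Bool k) → select (replicate k 0) m ≡ 0
select-replicate-0 []          = refl
select-replicate-0 (true  ∷ m) = select-replicate-0 m
select-replicate-0 (false ∷ m) = select-replicate-0 m

select-updateAt-suc : ∀ {k} (x : Fin k) d m → select (updateAt d x suc) m ≡ 𝟙 (lookup m x) + select d m
select-updateAt-suc fzero    (a ∷ d) (true  ∷ m) = refl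
select-updateAt-suc fzero    (a ∷ d) (false ∷ m) = refl
select-updateAt-suc (fsuc x) (a ∷ d) (true  ∷ m) =
  trans (cong (a +_) (select-updateAt-suc x d m)) (x+[y+z]≡y+[x+z] a (𝟙 (lookup m x)) (select d m))
select-updateAt-suc (fsuc x) (a ∷ d) (false ∷ m) = select-updateAt-suc x d m

incidence : Fin 3 → Fin 3 → Vec Bool 6
incidence i j = tabulate (λ x → ⌊ List.lookup perms x i ≟ᶠ j ⌋)

-- Σₓ dₓ · letter x, the common endpoint of all words with letter counts d.
countMatrix : Vec ℕ 6 → Mat
countMatrix d i j = select d (incidence i j)

endpoint≡countMatrix : ∀ w i j → endpoint (map letter w) i j ≡ countMatrix (letterCounts w) i j
endpoint≡countMatrix []      i j = sym (select-replicate-0 (incidence i j))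
endpoint≡countMatrix (x ∷ w) i j = begin
  letter x i j + endpoint (map letter w) i j                       ≡⟨ cong₂ _+_ letter≡ (endpoint≡countMatrix w i j) ⟩
  𝟙 (lookup (incidence i j) x) + countMatrix (letterCounts w) i j  ≡⟨ select-updateAt-suc x (letterCounts w) (incidence i j) ⟨
  countMatrix (letterCounts (x ∷ w)) i j                           ∎
  where
  letter≡ : letter x i j ≡ 𝟙 (lookup (incidence i j) x)
  letter≡ = sym (cong 𝟙 (Vec.lookup∘tabulate (λ x → ⌊ List.lookup perms x i ≟ᶠ j ⌋) x))

T-and : ∀ bs → T (and bs) ⇔ All T bs
T-and []       = mk⇔ (λ _ → []) (λ _ → tt)
T-and (b ∷ bs) = mk⇔
  (λ h → let (tb , tbs) = Equivalence.to T-∧ h in tb ∷ Equivalence.to (T-and bs) tbs)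
  (λ { (tb ∷ tbs) → Equivalence.from T-∧ (tb , Equivalence.from (T-and bs) tbs) })

T-and-allFin : ∀ {n} (f : Fin n → Bool) → T (and (map f (allFin n))) ⇔ (∀ i → T (f i))
T-and-allFin {n} f = mk⇔
  (λ h i → All.lookup (map⁻ {f = f} (Equivalence.to (T-and (map f (allFin n))) h)) (∈-allFin i))
  (λ h → Equivalence.from (T-and (map f (allFin n))) (map⁺ (tabulate⁺ h)))

T-==ᴹ : ∀ A B → T (A ==ᴹ B) ⇔ (∀ i j → A i j ≡ B i j)
T-==ᴹ A B = mk⇔
  (λ h i j → ℕ.≡ᵇ⇒≡ _ _ (Equivalence.to (T-and-allFin (entry i)) (Equivalence.to (T-and-allFin row) h i) j))
  (λ A≡B → Equivalence.from (T-and-allFin row) λ i → Equivalence.from (T-and-allFin (entry i)) λ j → ℕ.≡⇒≡ᵇ _ _ (A≡B i j))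
  where
  entry : Fin 3 → Fin 3 → Bool
  entry i j = A i j ℕ.≡ᵇ B i j
  row : Fin 3 → Bool
  row i = and (map (entry i) (allFin 3))

-- The letter counts, in the order of perms, of the paths to sJ: each even permutation occurs
-- t times and each odd one s ∸ t times.
sJCounts : ℕ → ℕ → Vec ℕ 6
sJCounts s t = t ∷ s ∸ t ∷ s ∸ t ∷ t ∷ t ∷ s ∸ t ∷ []

countMatrix≡sJ⇔ : ∀ s d → (∀ i j → countMatrix d i j ≡ s) ⇔ (d ≡ sJCounts s (Vec.head d) × Vec.head d ≤ s)
countMatrix≡sJ⇔ s (a ∷ b ∷ c ∷ d ∷ e ∷ f ∷ []) = mk⇔ solve-line-sums sJCounts-semimagic
  where
  other-summand : ∀ {x y} → x + (y + 0) ≡ s → y ≡ s ∸ x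
  other-summand {x} {y} x+y≡s = trans (sym (ℕ.m+n∸m≡n x y)) (cong (_∸ x) (trans (cong (x +_) (sym (ℕ.+-identityʳ y))) x+y≡s))
  solve-line-sums : (∀ i j → countMatrix (a ∷ b ∷ c ∷ d ∷ e ∷ f ∷ []) i j ≡ s) →
                    (a ∷ b ∷ c ∷ d ∷ e ∷ f ∷ []) ≡ sJCounts s a × a ≤ s
  solve-line-sums M≡s =
    cong₂ _∷_ refl (cong₂ _∷_ b≡ (cong₂ _∷_ c≡ (cong₂ _∷_ d≡ (cong₂ _∷_ e≡ (cong₂ _∷_ f≡ refl))))) , a≤s
    where
    a≤s : a ≤ s
    a≤s = ℕ.m+n≤o⇒m≤o a (ℕ.≤-reflexive (trans (cong (a +_) (sym (ℕ.+-identityʳ b))) (M≡s fzero fzero)))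
    b≡ = other-summand {a} {b} (M≡s fzero fzero)
    c≡ = other-summand {a} {c} (M≡s (fsuc (fsuc fzero)) (fsuc (fsuc fzero)))
    f≡ = other-summand {a} {f} (M≡s (fsuc fzero) (fsuc fzero))
    s∸c≡a : s ∸ c ≡ a
    s∸c≡a = trans (cong (s ∸_) c≡) (ℕ.m∸[m∸n]≡n a≤s)
    d≡ = trans (other-summand {c} {d} (M≡s fzero (fsuc fzero))) s∸c≡a
    e≡ = trans (other-summand {c} {e} (M≡s (fsuc fzero) fzero)) s∸c≡a
  sJCounts-semimagic : (a ∷ b ∷ c ∷ d ∷ e ∷ f ∷ []) ≡ sJCounts s a × a ≤ s →
                       ∀ i j → countMatrix (a ∷ b ∷ c ∷ d ∷ e ∷ f ∷ []) i j ≡ s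
  sJCounts-semimagic (refl , a≤s) = λ where
      fzero               fzero               → even+odd
      fzero               (fsuc fzero)        → odd+even
      fzero               (fsuc (fsuc fzero)) → even+odd
      (fsuc fzero)        fzero               → odd+even
      (fsuc fzero)        (fsuc fzero)        → even+odd
      (fsuc fzero)        (fsuc (fsuc fzero)) → odd+even
      (fsuc (fsuc fzero)) fzero               → even+odd
      (fsuc (fsuc fzero)) (fsuc fzero)        → odd+even
      (fsuc (fsuc fzero)) (fsuc (fsuc fzero)) → even+odd
    where
    even+odd : a + (s ∸ a + 0) ≡ s
    even+odd = trans (cong (a +_) (ℕ.+-identityʳ (s ∸ a))) (ℕ.m+[n∸m]≡n a≤s)
    odd+even : s ∸ a + (a + 0) ≡ s
    odd+even = trans (cong (s ∸ a +_) (ℕ.+-identityʳ a)) (ℕ.m∸n+n≡m a≤s)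

endpoint≡sJ⇔ : ∀ s w → let d = letterCounts w in
               T (endpoint (map letter w) ==ᴹ (s ·J)) ⇔ (d ≡ sJCounts s (Vec.head d) × Vec.head d ≤ s)
endpoint≡sJ⇔ s w = ⇔.trans (T-==ᴹ _ _) (⇔.trans
  (mk⇔ (λ E i j → trans (sym (endpoint≡countMatrix w i j)) (E i j)) (λ E i j → trans (endpoint≡countMatrix w i j) (E i j)))
  (countMatrix≡sJ⇔ s (letterCounts w)))

𝟙-∧ : ∀ a b → 𝟙 (a ∧ b) ≡ 𝟙 a * 𝟙 b
𝟙-∧ true  b = sym (ℕ.+-identityʳ (𝟙 b))
𝟙-∧ false b = refl

∑-𝟙-≟ : ∀ a n → ∑[ t < suc n ] 𝟙 (does (a ℕ.≟ t)) ≡ 𝟙 (does (a ℕ.≤? n))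
∑-𝟙-≟ zero    zero    = refl
∑-𝟙-≟ (suc a) zero    = refl
∑-𝟙-≟ a       (suc n) = trans (cong (_+ 𝟙 (does (a ℕ.≟ suc n))) (∑-𝟙-≟ a n)) (step a n)
  where
  step : ∀ a n → 𝟙 (does (a ℕ.≤? n)) + 𝟙 (does (a ℕ.≟ suc n)) ≡ 𝟙 (does (a ℕ.≤? suc n))
  step zero          n       = refl
  step (suc zero)    zero    = refl
  step (suc zero)    (suc n) = refl
  step (suc (suc a)) zero    = refl
  step (suc (suc a)) (suc n) = step (suc a) n

𝟙-endpoint≡sJ : ∀ s w →
  𝟙 (endpoint (map letter w) ==ᴹ (s ·J)) ≡ ∑[ t < suc s ] 𝟙 (does (letterCounts w ≟ᵛ sJCounts s t))
𝟙-endpoint≡sJ s w = begin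
  𝟙 (endpoint (map letter w) ==ᴹ (s ·J))
    ≡⟨ cong 𝟙 (does-⇔ (endpoint≡sJ⇔ s w) (T? _) (d ≟ᵛ sJCounts s a ×-dec a ℕ.≤? s)) ⟩
  𝟙 (does (d ≟ᵛ sJCounts s a) ∧ does (a ℕ.≤? s))
    ≡⟨ 𝟙-∧ (does (d ≟ᵛ sJCounts s a)) (does (a ℕ.≤? s)) ⟩
  δ * 𝟙 (does (a ℕ.≤? s))
    ≡⟨ cong (δ *_) (∑-𝟙-≟ a s) ⟨
  δ * (∑[ t < suc s ] 𝟙 (does (a ℕ.≟ t)))
    ≡⟨ *-distribˡ-∑ δ (suc s) (λ t → 𝟙 (does (a ℕ.≟ t))) ⟩
  ∑[ t < suc s ] δ * 𝟙 (does (a ℕ.≟ t))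
    ≡⟨ ∑-cong (suc s) (λ {t} _ → only-t≡a t) ⟩
  ∑[ t < suc s ] 𝟙 (does (d ≟ᵛ sJCounts s t))
    ∎
  where
  d = letterCounts w
  a = Vec.head d
  δ = 𝟙 (does (d ≟ᵛ sJCounts s a))
  only-t≡a : ∀ t → δ * 𝟙 (does (a ℕ.≟ t)) ≡ 𝟙 (does (d ≟ᵛ sJCounts s t))
  only-t≡a t with a ℕ.≟ t
  ... | yes refl = trans (cong (λ b → δ * 𝟙 b) (dec-true (a ℕ.≟ a) refl)) (ℕ.*-identityʳ δ)
  ... | no  a≢t  = begin
    δ * 𝟙 (does (a ℕ.≟ t))        ≡⟨ cong (λ b → δ * 𝟙 b) (dec-false (a ℕ.≟ t) a≢t) ⟩
    δ * 0                          ≡⟨ ℕ.*-zeroʳ δ ⟩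
    0                              ≡⟨ cong 𝟙 (dec-false (d ≟ᵛ sJCounts s t) (λ d≡ → a≢t (cong Vec.head d≡))) ⟨
    𝟙 (does (d ≟ᵛ sJCounts s t))  ∎

p≡∑#words : ∀ s → p s ≡ ∑[ t < suc s ] #words (s + s + s) (sJCounts s t)
p≡∑#words s = begin
  length (filterᵇ reaches-sJ (steps (s + s + s)))
    ≡⟨ length-filterᵇ reaches-sJ (steps (s + s + s)) ⟩
  sum (map (𝟙 ∘ reaches-sJ) (steps (s + s + s)))
    ≡⟨ cong (sum ∘ map (𝟙 ∘ reaches-sJ)) (steps≡map-letter (s + s + s)) ⟩
  sum (map (𝟙 ∘ reaches-sJ) (map (map letter) W))
    ≡⟨ cong sum (List.map-∘ W) ⟨
  sum (map (λ w → 𝟙 (reaches-sJ (map letter w))) W)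
    ≡⟨ sum-map-cong (𝟙-endpoint≡sJ s) W ⟩
  sum (map (λ w → ∑[ t < suc s ] 𝟙 (does (letterCounts w ≟ᵛ sJCounts s t))) W)
    ≡⟨ sum-map-∑ (suc s) (λ w t → 𝟙 (does (letterCounts w ≟ᵛ sJCounts s t))) W ⟩
  ∑[ t < suc s ] #words (s + s + s) (sJCounts s t)
    ∎
  where
  W = sequences (allFin 6) (s + s + s)
  reaches-sJ : List Mat → Bool
  reaches-sJ w = endpoint w ==ᴹ (s ·J)

sum-sJCounts : ∀ {s t} → t ≤ s → Vec.sum (sJCounts s t) ≡ s + s + s
sum-sJCounts {s} {t} t≤s = trans (regroup t (s ∸ t)) (cong (λ x → x + x + x) (ℕ.m+[n∸m]≡n t≤s))
  where
  regroup : ∀ t u → t + (u + (u + (t + (t + (u + 0))))) ≡ (t + u) + (t + u) + (t + u)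
  regroup = solve-∀

∏!-sJCounts : ∀ s t → ∏! (sJCounts s t) ≡ (t ! * (s ∸ t) !) * (t ! * (s ∸ t) !) * (t ! * (s ∸ t) !)
∏!-sJCounts s t = regroup (t !) ((s ∸ t) !)
  where
  regroup : ∀ x y → x * (y * (y * (x * (x * (y * 1))))) ≡ (x * y) * (x * y) * (x * y)
  regroup = solve-∀

cube≢0 : ∀ m → .{{ℕ.NonZero m}} → ℕ.NonZero (m * m * m)
cube≢0 m = ℕ.m*n≢0 (m * m) m {{ℕ.m*n≢0 m m}}

centralTrinomial : ℕ → ℕ
centralTrinomial s = ((s + s + s) ! / (s ! * s ! * s !)) {{cube≢0 (s !) {{s ℕ.!≢0}}}}

centralTrinomial*s!³≡[3s]! : ∀ s → centralTrinomial s * (s ! * s ! * s !) ≡ (s + s + s) !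
centralTrinomial*s!³≡[3s]! s = m/n*n≡m {{cube≢0 (s !) {{s ℕ.!≢0}}}} (divides (#words (s + s + s) (sJCounts s 0)) (sym (begin
  #words (s + s + s) (sJCounts s 0) * (s ! * s ! * s !)
    ≡⟨ cong (λ x → #words (s + s + s) (sJCounts s 0) * (x * x * x)) (ℕ.*-identityˡ (s !)) ⟨
  #words (s + s + s) (sJCounts s 0) * ((0 ! * s !) * (0 ! * s !) * (0 ! * s !))
    ≡⟨ cong (#words (s + s + s) (sJCounts s 0) *_) (∏!-sJCounts s 0) ⟨
  #words (s + s + s) (sJCounts s 0) * ∏! (sJCounts s 0)
    ≡⟨ #words*∏!≡n! (s + s + s) (sJCounts s 0) (sum-sJCounts {s} {0} ℕ.z≤n) ⟩
  (s + s + s) ! ∎)))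

#words-sJCounts : ∀ {s t} → t ≤ s → #words (s + s + s) (sJCounts s t) ≡ centralTrinomial s * (s C t) ^ 3
#words-sJCounts {s} {t} t≤s = ℕ.*-cancelʳ-≡ _ _ (g * g * g) {{cube≢0 g {{t ℕ.!* (s ∸ t) !≢0}}}} (begin
  #words (s + s + s) (sJCounts s t) * (g * g * g)         ≡⟨ cong (#words (s + s + s) (sJCounts s t) *_) (∏!-sJCounts s t) ⟨
  #words (s + s + s) (sJCounts s t) * ∏! (sJCounts s t)   ≡⟨ #words*∏!≡n! (s + s + s) (sJCounts s t) (sum-sJCounts t≤s) ⟩
  (s + s + s) !                                           ≡⟨ centralTrinomial*s!³≡[3s]! s ⟨
  centralTrinomial s * (s ! * s ! * s !)                  ≡⟨ cong (λ x → centralTrinomial s * (x * x * x)) (nCk*[k!*[n∸k]!]≡n! t≤s) ⟨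
  centralTrinomial s * ((s C t) * g * ((s C t) * g) * ((s C t) * g)) ≡⟨ regroup (centralTrinomial s) (s C t) g ⟩
  centralTrinomial s * (s C t) ^ 3 * (g * g * g)          ∎)
  where
  g = t ! * (s ∸ t) !
  regroup : ∀ m c g → m * (c * g * (c * g) * (c * g)) ≡ m * (c * (c * (c * 1))) * (g * g * g)
  regroup = solve-∀

p≡centralTrinomial*franel : ∀ s → p s ≡ centralTrinomial s * franel s
p≡centralTrinomial*franel s = begin
  p s                                                 ≡⟨ p≡∑#words s ⟩
  ∑[ t < suc s ] #words (s + s + s) (sJCounts s t)   ≡⟨ ∑-cong (suc s) (λ t<1+s → #words-sJCounts (ℕ.≤-pred t<1+s)) ⟩
  ∑[ t < suc s ] centralTrinomial s * (s C t) ^ 3     ≡⟨ *-distribˡ-∑ (centralTrinomial s) (suc s) (λ t → (s C t) ^ 3) ⟨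
  centralTrinomial s * franel s                       ∎

centralTrinomial-recurrence : ∀ s → suc s * suc s * centralTrinomial (suc s) ≡ 3 * (3 * s + 2) * (3 * s + 1) * centralTrinomial s
centralTrinomial-recurrence s = ℕ.*-cancelʳ-≡ _ _ (suc s * s!³) {{ℕ.m*n≢0 (suc s) s!³ {{_}} {{cube≢0 (s !) {{s ℕ.!≢0}}}}}} (begin
  suc s * suc s * m′ * (suc s * s!³)            ≡⟨ regroup₁ (suc s) m′ (s !) ⟩
  m′ * (suc s ! * suc s ! * suc s !)            ≡⟨ centralTrinomial*s!³≡[3s]! (suc s) ⟩
  (suc s + suc s + suc s) !                     ≡⟨ cong _! (3+3s s) ⟩
  (3 + X) * ((2 + X) * ((1 + X) * X !))         ≡⟨ cong (λ x → (3 + X) * ((2 + X) * ((1 + X) * x))) (centralTrinomial*s!³≡[3s]! s) ⟨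
  (3 + X) * ((2 + X) * ((1 + X) * (m * s!³)))   ≡⟨ regroup₂ s m s!³ ⟩
  3 * (3 * s + 2) * (3 * s + 1) * m * (suc s * s!³) ∎)
  where
  m  = centralTrinomial s
  m′ = centralTrinomial (suc s)
  s!³ = s ! * s ! * s !
  X = s + s + s
  3+3s : ∀ s → suc s + suc s + suc s ≡ 3 + (s + s + s)
  3+3s = solve-∀
  regroup₁ : ∀ a m f → a * a * m * (a * (f * f * f)) ≡ m * (a * f * (a * f) * (a * f))
  regroup₁ = solve-∀
  regroup₂ : ∀ s m f → (3 + (s + s + s)) * ((2 + (s + s + s)) * ((1 + (s + s + s)) * (m * f)))
                       ≡ 3 * (3 * s + 2) * (3 * s + 1) * m * (suc s * f)
  regroup₂ = solve-∀

9[1+r]²∸4≡[3r+1][3r+5] : ∀ r → 9 * suc r ^ 2 ∸ 4 ≡ (3 * r + 1) * (3 * r + 5)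
9[1+r]²∸4≡[3r+1][3r+5] r = trans (cong (_∸ 4) (expand r)) (ℕ.m+n∸n≡m _ 4)
  where
  expand : ∀ r → 9 * (suc r * (suc r * 1)) ≡ (3 * r + 1) * (3 * r + 5) + 4
  expand = solve-∀

9[1+r]²∸1≡[3r+2][3r+4] : ∀ r → 9 * suc r ^ 2 ∸ 1 ≡ (3 * r + 2) * (3 * r + 4)
9[1+r]²∸1≡[3r+2][3r+4] r = trans (cong (_∸ 1) (expand r)) (ℕ.m+n∸n≡m _ 1)
  where
  expand : ∀ r → 9 * (suc r * (suc r * 1)) ≡ (3 * r + 2) * (3 * r + 4) + 1
  expand = solve-∀

recurrence-of-product : (a m f : ℕ → ℕ) → (∀ s → a s ≡ m s * f s) →
  (∀ s → suc s * suc s * m (suc s) ≡ 3 * (3 * s + 2) * (3 * s + 1) * m s) →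
  (∀ n → let N = suc n in (1 + N) * (1 + N) * f (1 + N) ≡ (7 * N * N + 7 * N + 2) * f N + 8 * N * N * f n) →
  ∀ (s : ℕ) → s > 0 →
    (s + 1) ^ 4 * a (s + 1)
    ≡ 3 * (3 * s + 2) * (3 * s + 1) * (7 * s ^ 2 + 7 * s + 2) * a s
    + 72 * (9 * s ^ 2 ∸ 4) * (9 * s ^ 2 ∸ 1) * a (s ∸ 1)
recurrence-of-product a m f a≡mf m-rec f-rec (suc r) _
  rewrite ℕ.+-comm r 1 | 9[1+r]²∸4≡[3r+1][3r+5] r | 9[1+r]²∸1≡[3r+2][3r+4] r
        | a≡mf r | a≡mf (suc r) | a≡mf (suc (suc r)) = begin
    S₂ * (S₂ * (S₂ * (S₂ * 1))) * (m S₂ * f S₂)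
      ≡⟨ split S₂ (m S₂) (f S₂) ⟩
    (S₂ * S₂ * m S₂) * (S₂ * S₂ * f S₂)
      ≡⟨ cong₂ _*_ (m-rec S₁) (f-rec r) ⟩
    (3 * (3 * S₁ + 2) * (3 * S₁ + 1) * m S₁) * ((7 * S₁ * S₁ + 7 * S₁ + 2) * f S₁ + 8 * S₁ * S₁ * f r)
      ≡⟨ expand r (m S₁) (f S₁) (f r) ⟩
    c₁ + 24 * (3 * S₁ + 2) * (3 * S₁ + 1) * (S₁ * S₁ * m S₁) * f r
      ≡⟨ cong (λ x → c₁ + 24 * (3 * S₁ + 2) * (3 * S₁ + 1) * x * f r) (m-rec r) ⟩
    c₁ + 24 * (3 * S₁ + 2) * (3 * S₁ + 1) * (3 * (3 * r + 2) * (3 * r + 1) * m r) * f r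
      ≡⟨ collect r (m r) (f r) c₁ ⟩
    c₁ + 72 * ((3 * r + 1) * (3 * r + 5)) * ((3 * r + 2) * (3 * r + 4)) * (m r * f r) ∎
  where
  S₁ = suc r
  S₂ = suc S₁
  c₁ = 3 * (3 * S₁ + 2) * (3 * S₁ + 1) * (7 * (S₁ * (S₁ * 1)) + 7 * S₁ + 2) * (m S₁ * f S₁)
  split : ∀ x y z → x * (x * (x * (x * 1))) * (y * z) ≡ (x * x * y) * (x * x * z)
  split = solve-∀
  expand : ∀ r m₁ f₁ f₀ →
    (3 * (3 * suc r + 2) * (3 * suc r + 1) * m₁) * ((7 * suc r * suc r + 7 * suc r + 2) * f₁ + 8 * suc r * suc r * f₀)
    ≡ 3 * (3 * suc r + 2) * (3 * suc r + 1) * (7 * (suc r * (suc r * 1)) + 7 * suc r + 2) * (m₁ * f₁)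
      + 24 * (3 * suc r + 2) * (3 * suc r + 1) * (suc r * suc r * m₁) * f₀
  expand = solve-∀
  collect : ∀ r m₀ f₀ c → c + 24 * (3 * suc r + 2) * (3 * suc r + 1) * (3 * (3 * r + 2) * (3 * r + 1) * m₀) * f₀
    ≡ c + 72 * ((3 * r + 1) * (3 * r + 5)) * ((3 * r + 2) * (3 * r + 4)) * (m₀ * f₀)
  collect = solve-∀

corollary5p5 : ∀ (s : ℕ) → s > 0 →
    (s + 1) ^ 4 * p (s + 1)
    ≡ 3 * (3 * s + 2) * (3 * s + 1) * (7 * s ^ 2 + 7 * s + 2) * p s
    + 72 * (9 * s ^ 2 ∸ 4) * (9 * s ^ 2 ∸ 1) * p (s ∸ 1)
corollary5p5 =
  recurrence-of-product p centralTrinomial franel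
    p≡centralTrinomial*franel centralTrinomial-recurrence franel-recurrence
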